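{- Assume the abc conjecture holds. For every integer $n\ge 5$, there are only finitely many powerful numbers of the form $x^n+y^n$ with $x,y$ positive integers and $\gcd(x,y)=1$.
   Context: For a positive integer $n$, $\mathrm{rad}(n)$ denotes the product of the distinct primes dividing $n$. The abc conjecture states: for every real $\epsilon>0$ there are only finitely many triples $(a,b,c)$ of coprime positive integers with $a+b=c$ and $c>(\mathrm{rad}(abc))^{1+\epsilon}$. A positive integer $z$ is powerful if $p^2\mid z$ for every prime $p$ with $p\mid z$. -}

module Defs where

open import Data.Nat using (ℕ; zero; suc; _+_; _*_; _^_; _≤_; _<_)
open import Data.Nat.Divisibility using (_∣_; _∣?_)
open import Data.Nat.Primality using (Prime; prime?)
open import Data.Nat.Coprimality using (Coprime)
open import Data.List using (List; map; upTo)
open import Data.Nat.ListAction using (product)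
open import Relation.Binary.PropositionalEquality using (_≡_)
open import Data.List.Membership.Propositional using (_∈_)
open import Data.Product using (_×_; _,_; ∃)
open import Relation.Nullary using (yes; no; _×-dec_)

-- rad n = product of the distinct primes dividing n
-- (computed as the product of all primes p ≤ n with p ∣ n; rad 0 = 1 by this
-- convention, which is irrelevant below since only positive arguments occur).
radFactor : ℕ → ℕ → ℕ
radFactor n p with prime? p ×-dec (p ∣? n)
... | yes _ = p
... | no  _ = 1

rad : ℕ → ℕ
rad n = product (map (radFactor n) (upTo (suc n)))

Powerful : ℕ → Set
Powerful z = 0 < z × (∀ p → Prime p → p ∣ z → p * p ∣ z)

-- abc triple with exceptional quality for ε = e / q :
-- c > rad(abc)^(1+e/q)  ⟺  c^q > rad(abc)^(q+e).
ABCException : ℕ → ℕ → ℕ → ℕ → ℕ → Set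
ABCException e q a b c =
  0 < a × 0 < b × Coprime a b × a + b ≡ c × rad (a * b * c) ^ (q + e) < c ^ q

ABC : Set
ABC = ∀ e q → 0 < e → 0 < q →
  ∃ λ (L : List (ℕ × ℕ × ℕ)) → ∀ a b c → ABCException e q a b c → (a , b , c) ∈ L

-- Under abc the triple (xⁿ, yⁿ, z) with z = xⁿ + yⁿ powerful is exceptional for ε = (n-4)/(n+4).
-- Every prime of xⁿyⁿz divides x, y or z, and z is powerful, so rad(xⁿyⁿz)² divides (xy)²z.
-- As xⁿ, yⁿ < z we get ((xy)²z)ⁿ = (xⁿyⁿ)²zⁿ < zⁿ⁺⁴, i.e. rad(xⁿyⁿz)^(2n) < z^(n+4),
-- and 2n = (n+4) + (n-4). So each such z is the third entry of one of the finitely many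
-- exceptional triples.
module Submission where

open import Defs
open import Data.Nat using (ℕ; zero; suc; _+_; _*_; _∸_; _^_; _≤_; _<_; z≤n; s≤s; NonZero; >-nonZero)
open import Data.Nat.Properties
open import Data.Nat.Divisibility
open import Data.Nat.Primality using (Prime; prime?; euclidsLemma; ¬prime[1]; prime⇒nonZero; prime⇒irreducible)
open import Data.Nat.Coprimality using (Coprime; coprime-divisor)
import Data.Nat.Coprimality as Coprime
open import Data.List using (List; map; upTo; _++_; _∷ʳ_; [_])
open import Data.List.Properties using (upTo-∷ʳ; map-++)
open import Data.Nat.ListAction using (product)
open import Data.Nat.ListAction.Properties using (product-++)
open import Data.List.Membership.Propositional using (_∈_)
open import Data.List.Membership.Propositional.Properties using (∈-map⁺)
open import Data.Product using (∃; _×_; _,_)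
open import Data.Sum using (_⊎_; inj₁; inj₂; [_,_]′)
open import Data.Empty using (⊥-elim)
open import Function using (id)
open import Relation.Nullary using (yes; no; ¬_; _×-dec_)
open import Relation.Binary.PropositionalEquality hiding ([_])
open import Algebra.Properties.CommutativeSemigroup *-commutativeSemigroup using (interchange)

^-distribʳ-* : ∀ a b n → (a * b) ^ n ≡ a ^ n * b ^ n
^-distribʳ-* a b zero    = refl
^-distribʳ-* a b (suc n) = begin
  a * b * (a * b) ^ n     ≡⟨ cong (a * b *_) (^-distribʳ-* a b n) ⟩
  a * b * (a ^ n * b ^ n) ≡⟨ interchange a b (a ^ n) (b ^ n) ⟩
  a * a ^ n * (b * b ^ n) ∎
  where open ≡-Reasoning

^-comm : ∀ a m n → (a ^ m) ^ n ≡ (a ^ n) ^ m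
^-comm a m n = begin
  (a ^ m) ^ n ≡⟨ ^-*-assoc a m n ⟩
  a ^ (m * n) ≡⟨ cong (a ^_) (*-comm m n) ⟩
  a ^ (n * m) ≡⟨ ^-*-assoc a n m ⟨
  (a ^ n) ^ m ∎
  where open ≡-Reasoning

^2≡* : ∀ a → a ^ 2 ≡ a * a
^2≡* a = cong (a *_) (*-identityʳ a)

^-monoˡ-∣ : ∀ {a b} e → a ∣ b → a ^ e ∣ b ^ e
^-monoˡ-∣ zero    _   = ∣-refl
^-monoˡ-∣ (suc e) a∣b = *-pres-∣ a∣b (^-monoˡ-∣ e a∣b)

prime∤1 : ∀ {p} → Prime p → ¬ p ∣ 1
prime∤1 pp p∣1 = ¬prime[1] (subst Prime (∣1⇒≡1 p∣1) pp)

prime∣^⇒∣ : ∀ {p} m n → Prime p → p ∣ m ^ n → p ∣ m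
prime∣^⇒∣ m zero    pp p∣1 = ⊥-elim (prime∤1 pp p∣1)
prime∣^⇒∣ m (suc n) pp p∣m^n = [ id , prime∣^⇒∣ m n pp ]′ (euclidsLemma m (m ^ n) pp p∣m^n)

prime∤⇒coprime : ∀ {p n} → Prime p → ¬ p ∣ n → Coprime p n
prime∤⇒coprime pp p∤n (d∣p , d∣n) with prime⇒irreducible pp d∣p
... | inj₁ d≡1  = d≡1
... | inj₂ refl = ⊥-elim (p∤n d∣n)

coprime-*ʳ : ∀ {a b c} → Coprime a b → Coprime a c → Coprime a (b * c)
coprime-*ʳ ab ac (d∣a , d∣bc) =
  ac (d∣a , coprime-divisor (λ (e∣d , e∣b) → ab (∣-trans e∣d d∣a , e∣b)) d∣bc)

coprime-^ʳ : ∀ {a b} n → Coprime a b → Coprime a (b ^ n)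
coprime-^ʳ zero    _  (_ , d∣1) = ∣1⇒≡1 d∣1
coprime-^ʳ (suc n) ab = coprime-*ʳ ab (coprime-^ʳ n ab)

coprime-^ : ∀ {a b} n → Coprime a b → Coprime (a ^ n) (b ^ n)
coprime-^ n ab = Coprime.sym (coprime-^ʳ n (Coprime.sym (coprime-^ʳ n ab)))

coprime-∣⇒*∣ : ∀ {a b k} → Coprime a b → a ∣ k → b ∣ k → a * b ∣ k
coprime-∣⇒*∣ {a} {b} ab (divides-refl q) b∣qa =
  subst (_∣ q * a) (*-comm b a) (*-monoˡ-∣ a (coprime-divisor (Coprime.sym ab) (subst (b ∣_) (*-comm q a) b∣qa)))

radBelow : ℕ → ℕ → ℕ
radBelow m N = product (map (radFactor m) (upTo N))

radBelow-suc : ∀ m N → radBelow m (suc N) ≡ radBelow m N * radFactor m N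
radBelow-suc m N = begin
  product (map (radFactor m) (upTo (suc N)))             ≡⟨ cong (λ ns → product (map (radFactor m) ns)) (upTo-∷ʳ N) ⟨
  product (map (radFactor m) (upTo N ∷ʳ N))              ≡⟨ cong product (map-++ (radFactor m) (upTo N) [ N ]) ⟩
  product (map (radFactor m) (upTo N) ++ [ radFactor m N ]) ≡⟨ product-++ (map (radFactor m) (upTo N)) _ ⟩
  radBelow m N * (radFactor m N * 1)                     ≡⟨ cong (radBelow m N *_) (*-identityʳ _) ⟩
  radBelow m N * radFactor m N                           ∎
  where open ≡-Reasoning

radFactor-cases : ∀ m N → radFactor m N ≡ 1 ⊎ (radFactor m N ≡ N × Prime N × N ∣ m)
radFactor-cases m N with prime? N ×-dec (N ∣? m)
... | yes (pN , N∣m) = inj₂ (refl , pN , N∣m)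
... | no _           = inj₁ refl

prime∤radBelow : ∀ m N {p} → Prime p → N ≤ p → ¬ p ∣ radBelow m N
prime∤radBelow m zero    pp _   p∣1 = prime∤1 pp p∣1
prime∤radBelow m (suc N) {p} pp N<p p∣rad
  with euclidsLemma (radBelow m N) (radFactor m N) pp (subst (p ∣_) (radBelow-suc m N) p∣rad)
... | inj₁ p∣rad′ = prime∤radBelow m N pp (<⇒≤ N<p) p∣rad′
... | inj₂ p∣f with radFactor-cases m N
...   | inj₁ f≡1            = prime∤1 pp (subst (p ∣_) f≡1 p∣f)
...   | inj₂ (f≡N , pN , _) = <⇒≱ N<p (∣⇒≤ ⦃ prime⇒nonZero pN ⦄ (subst (p ∣_) f≡N p∣f))

radBelow^∣ : ∀ m e k N → (∀ p → Prime p → p ∣ m → p ^ e ∣ k) → radBelow m N ^ e ∣ k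
radBelow^∣ m e k zero    _   = subst (_∣ k) (sym (^-zeroˡ e)) (1∣ k)
radBelow^∣ m e k (suc N) hyp
  rewrite radBelow-suc m N | ^-distribʳ-* (radBelow m N) (radFactor m N) e
  with radFactor-cases m N
... | inj₁ f≡1 rewrite f≡1 | ^-zeroˡ e | *-identityʳ (radBelow m N ^ e) = radBelow^∣ m e k N hyp
... | inj₂ (f≡N , pN , N∣m) rewrite f≡N =
  coprime-∣⇒*∣ (coprime-^ e (Coprime.sym (prime∤⇒coprime pN (prime∤radBelow m N pN ≤-refl))))
    (radBelow^∣ m e k N hyp) (hyp N pN N∣m)

rad^∣ : ∀ m e k → (∀ p → Prime p → p ∣ m → p ^ e ∣ k) → rad m ^ e ∣ k
rad^∣ m e k = radBelow^∣ m e k (suc m)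

rad[xⁿyⁿz]²∣[xy]²z : ∀ x y n {z} → Powerful z → rad (x ^ n * y ^ n * z) ^ 2 ∣ (x * y) ^ 2 * z
rad[xⁿyⁿz]²∣[xy]²z x y n {z} (_ , powerful) = rad^∣ (x ^ n * y ^ n * z) 2 ((x * y) ^ 2 * z) prime²∣
  where
  prime∣xy : ∀ {p} → Prime p → p ∣ x ^ n * y ^ n → p ∣ x * y
  prime∣xy pp p∣xⁿyⁿ = [ (λ p∣xⁿ → ∣m⇒∣m*n y (prime∣^⇒∣ x n pp p∣xⁿ)) , (λ p∣yⁿ → ∣n⇒∣m*n x (prime∣^⇒∣ y n pp p∣yⁿ)) ]′
    (euclidsLemma (x ^ n) (y ^ n) pp p∣xⁿyⁿ)
  prime²∣ : ∀ p → Prime p → p ∣ x ^ n * y ^ n * z → p ^ 2 ∣ (x * y) ^ 2 * z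
  prime²∣ p pp p∣xⁿyⁿz with euclidsLemma (x ^ n * y ^ n) z pp p∣xⁿyⁿz
  ... | inj₁ p∣xⁿyⁿ = ∣m⇒∣m*n z (^-monoˡ-∣ 2 (prime∣xy pp p∣xⁿyⁿ))
  ... | inj₂ p∣z    = ∣n⇒∣m*n ((x * y) ^ 2) (subst (_∣ z) (sym (^2≡* p)) (powerful p pp p∣z))

[xy]²z^n<z^[n+4] : ∀ {x y z} n → x ^ n < z → y ^ n < z → ((x * y) ^ 2 * z) ^ n < z ^ (n + 4)
[xy]²z^n<z^[n+4] {x} {y} {z} n xⁿ<z yⁿ<z = begin-strict
  ((x * y) ^ 2 * z) ^ n       ≡⟨ ^-distribʳ-* ((x * y) ^ 2) z n ⟩
  ((x * y) ^ 2) ^ n * z ^ n   ≡⟨ cong (_* z ^ n) (^-comm (x * y) 2 n) ⟩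
  ((x * y) ^ n) ^ 2 * z ^ n   ≡⟨ cong (λ w → w ^ 2 * z ^ n) (^-distribʳ-* x y n) ⟩
  (x ^ n * y ^ n) ^ 2 * z ^ n <⟨ *-monoˡ-< (z ^ n) (^-monoˡ-< 2 (*-mono-< xⁿ<z yⁿ<z)) ⟩
  (z * z) ^ 2 * z ^ n         ≡⟨ cong (λ w → w ^ 2 * z ^ n) (^2≡* z) ⟨
  (z ^ 2) ^ 2 * z ^ n         ≡⟨ cong (_* z ^ n) (^-*-assoc z 2 2) ⟩
  z ^ 4 * z ^ n               ≡⟨ ^-distribˡ-+-* z 4 n ⟨
  z ^ (4 + n)                 ≡⟨ cong (z ^_) (+-comm 4 n) ⟩
  z ^ (n + 4)                 ∎
  where
  open ≤-Reasoning
  instance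
    _ = >-nonZero (≤-<-trans z≤n xⁿ<z)
    _ = m^n≢0 z n

n+4+[n∸4]≡2*n : ∀ n → 4 ≤ n → n + 4 + (n ∸ 4) ≡ 2 * n
n+4+[n∸4]≡2*n n 4≤n = begin
  n + 4 + (n ∸ 4)   ≡⟨ +-assoc n 4 (n ∸ 4) ⟩
  n + (4 + (n ∸ 4)) ≡⟨ cong (n +_) (m+[n∸m]≡n 4≤n) ⟩
  n + n             ≡⟨ cong (n +_) (+-identityʳ n) ⟨
  2 * n             ∎
  where open ≡-Reasoning

powerfulPowerSum⇒abcException : ∀ {x y z} n → 4 ≤ n → 0 < x → 0 < y → Coprime x y →
  Powerful z → z ≡ x ^ n + y ^ n → ABCException (n ∸ 4) (n + 4) (x ^ n) (y ^ n) z
powerfulPowerSum⇒abcException {x} {y} {z} n 4≤n x>0 y>0 x⊥y powerful refl =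
  m^n>0 x n , m^n>0 y n , coprime-^ n x⊥y , refl , radPower<zPower
  where
  instance
    _ = >-nonZero x>0
    _ = >-nonZero y>0
    _ = m*n≢0 x y
  R = rad (x ^ n * y ^ n * z)
  xⁿ<z : x ^ n < z
  xⁿ<z = m<m+n (x ^ n) (m^n>0 y n)
  yⁿ<z : y ^ n < z
  yⁿ<z = m<n+m (y ^ n) (m^n>0 x n)
  [xy]²z≢0 : NonZero ((x * y) ^ 2 * z)
  [xy]²z≢0 = >-nonZero (*-mono-< (m^n>0 (x * y) 2) (≤-<-trans z≤n xⁿ<z))
  radPower<zPower : R ^ (n + 4 + (n ∸ 4)) < z ^ (n + 4)
  radPower<zPower = begin-strict
    R ^ (n + 4 + (n ∸ 4)) ≡⟨ cong (R ^_) (n+4+[n∸4]≡2*n n 4≤n) ⟩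
    R ^ (2 * n)           ≡⟨ ^-*-assoc R 2 n ⟨
    (R ^ 2) ^ n           ≤⟨ ^-monoˡ-≤ n (∣⇒≤ ⦃ [xy]²z≢0 ⦄ (rad[xⁿyⁿz]²∣[xy]²z x y n powerful)) ⟩
    ((x * y) ^ 2 * z) ^ n <⟨ [xy]²z^n<z^[n+4] n xⁿ<z yⁿ<z ⟩
    z ^ (n + 4)           ∎
    where open ≤-Reasoning

mainTheorem2 : ABC → ∀ n → 5 ≤ n →
    ∃ λ (L : List ℕ) → ∀ z → Powerful z →
      (∃ λ x → ∃ λ y → 0 < x × 0 < y × Coprime x y × z ≡ x ^ n + y ^ n) →
      z ∈ L
mainTheorem2 abc n 5≤n with abc (n ∸ 4) (n + 4) (m<n⇒0<n∸m 5≤n) (≤-trans (s≤s z≤n) (m≤n+m 4 n))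
... | L , exceptional = map third L , λ z powerful (x , y , x>0 , y>0 , x⊥y , z≡) →
  ∈-map⁺ third (exceptional (x ^ n) (y ^ n) z
    (powerfulPowerSum⇒abcException n (≤-trans (n≤1+n 4) 5≤n) x>0 y>0 x⊥y powerful z≡))
  where
  third : ℕ × ℕ × ℕ → ℕ
  third (_ , _ , c) = c
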